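{- Let $\Sigma$ be an alphabet and $\sigma:X\times 2\to\mathcal P(\Sigma^\star)$ an interpretation such that $\epsilon\notin\sigma(y)$ for all $y\in X\times 2$. Then there exist an alphabet $\Sigma'$, an interpretation $\sigma'':X\to\mathcal P(\Sigma'^\star)$ and a function $\psi:\mathcal P(\Sigma'^\star)\to\mathcal P(\Sigma^\star)$ such that for every clean expression $e$, $[\![\uparrow e]\!]_\sigma=\psi([\![e]\!]_{\sigma''})$.
   Context: Fix a set $X$ of variables and let $2=\{\top,\bot\}$. For a set $Y$ of variables, simple expressions over $Y$ are generated by $e,f::= y\mid 0\mid e+f\mid e\cdot f\mid e\cap f\mid e^+$ ($y\in Y$). One-free expressions over $X$ are generated by $e,f::= x\mid 0\mid e+f\mid e\cdot f\mid e\cap f\mid e^+\mid\overline e$; such an expression is clean if the mirror operator $\overline{\cdot}$ is only applied to variables. For clean $e$, $\uparrow e$ is the simple expression over $X\times 2$ obtained by replacing each mirrored variable $\overline x$ by the variable $(x,\bot)$ and each other occurrence of a variable $x$ by $(x,\top)$. Semantics: for an alphabet $\Sigma$ and $\sigma:Y\to\mathcal P(\Sigma^\star)$, $[\![y]\!]_\sigma=\sigma(y)$, $[\![0]\!]_\sigma=\emptyset$, $+$ union, $\cap$ intersection, $\cdot$ concatenation, $e^+$ is $\bigcup_{n\ge1}[\![e]\!]_\sigma^n$, $\overline e$ the set of reversed words of $[\![e]\!]_\sigma$. -}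

module Defs where

open import Data.Bool using (Bool; true; false)
open import Data.List using (List; []; _∷_; _++_; reverse)
open import Data.Product using (Σ; ∃; ∃-syntax; _×_; _,_)
open import Data.Sum using (_⊎_)
open import Data.Empty using (⊥)
open import Data.Unit using (⊤)
open import Data.Nat using (ℕ; zero; suc)
open import Relation.Binary.PropositionalEquality using (_≡_)
open import Relation.Nullary using (¬_)

-- 2 = {⊤,⊥} is rendered as Bool: true = ⊤ (plain), false = ⊥ (mirrored)

Lang : Set → Set₁
Lang Σ = List Σ → Set

_≐_ : {Σ : Set} → Lang Σ → Lang Σ → Set
L ≐ M = ∀ w → (L w → M w) × (M w → L w)

∅ : {Σ : Set} → Lang Σ
∅ _ = ⊥

_∪_ : {Σ : Set} → Lang Σ → Lang Σ → Lang Σ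
(L ∪ M) w = L w ⊎ M w

_∩_ : {Σ : Set} → Lang Σ → Lang Σ → Lang Σ
(L ∩ M) w = L w × M w

_·_ : {Σ : Set} → Lang Σ → Lang Σ → Lang Σ
(L · M) w = ∃[ u ] ∃[ v ] (w ≡ u ++ v × L u × M v)

-- L^(n+1)
pow : {Σ : Set} → Lang Σ → ℕ → Lang Σ
pow L zero = L
pow L (suc n) = L · pow L n

plus : {Σ : Set} → Lang Σ → Lang Σ
plus L w = ∃[ n ] pow L n w

mirror : {Σ : Set} → Lang Σ → Lang Σ
mirror L w = L (reverse w)

data SExp (Y : Set) : Set where
  var  : Y → SExp Y
  zer  : SExp Y
  _⊕_  : SExp Y → SExp Y → SExp Y
  _⊙_  : SExp Y → SExp Y → SExp Y
  _⊓_  : SExp Y → SExp Y → SExp Y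
  _⁺   : SExp Y → SExp Y

⟦_⟧ˢ : {Y Σ : Set} → SExp Y → (Y → Lang Σ) → Lang Σ
⟦ var y ⟧ˢ σ = σ y
⟦ zer ⟧ˢ σ = ∅
⟦ e ⊕ f ⟧ˢ σ = ⟦ e ⟧ˢ σ ∪ ⟦ f ⟧ˢ σ
⟦ e ⊙ f ⟧ˢ σ = ⟦ e ⟧ˢ σ · ⟦ f ⟧ˢ σ
⟦ e ⊓ f ⟧ˢ σ = ⟦ e ⟧ˢ σ ∩ ⟦ f ⟧ˢ σ
⟦ e ⁺ ⟧ˢ σ = plus (⟦ e ⟧ˢ σ)

data OExp (X : Set) : Set where
  var  : X → OExp X
  zer  : OExp X
  _⊕_  : OExp X → OExp X → OExp X
  _⊙_  : OExp X → OExp X → OExp X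
  _⊓_  : OExp X → OExp X → OExp X
  _⁺   : OExp X → OExp X
  mir  : OExp X → OExp X

⟦_⟧ : {X Σ : Set} → OExp X → (X → Lang Σ) → Lang Σ
⟦ var x ⟧ σ = σ x
⟦ zer ⟧ σ = ∅
⟦ e ⊕ f ⟧ σ = ⟦ e ⟧ σ ∪ ⟦ f ⟧ σ
⟦ e ⊙ f ⟧ σ = ⟦ e ⟧ σ · ⟦ f ⟧ σ
⟦ e ⊓ f ⟧ σ = ⟦ e ⟧ σ ∩ ⟦ f ⟧ σ
⟦ e ⁺ ⟧ σ = plus (⟦ e ⟧ σ)
⟦ mir e ⟧ σ = mirror (⟦ e ⟧ σ)

data Clean {X : Set} : OExp X → Set where
  var  : ∀ x → Clean (var x)
  mirv : ∀ x → Clean (mir (var x))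
  zer  : Clean zer
  _⊕_  : ∀ {e f} → Clean e → Clean f → Clean (e ⊕ f)
  _⊙_  : ∀ {e f} → Clean e → Clean f → Clean (e ⊙ f)
  _⊓_  : ∀ {e f} → Clean e → Clean f → Clean (e ⊓ f)
  _⁺   : ∀ {e} → Clean e → Clean (e ⁺)

↑ : {X : Set} {e : OExp X} → Clean e → SExp (X × Bool)
↑ (var x) = var (x , true)
↑ (mirv x) = var (x , false)
↑ zer = zer
↑ (c ⊕ d) = ↑ c ⊕ ↑ d
↑ (c ⊙ d) = ↑ c ⊙ ↑ d
↑ (c ⊓ d) = ↑ c ⊓ ↑ d
↑ (c ⁺) = ↑ c ⁺

-- Encode a word a₁…aₙ over Σ as (a₁,⊤)(a₁,⊥)…(aₙ,⊤)(aₙ,⊥) over Σ × 2, and let σ″ x consist of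
-- the encodings of σ(x,⊤) together with the reversed encodings of σ(x,⊥). Taking ψ to be the
-- preimage under the encoding, variables and mirrored variables are recovered because a nonempty
-- encoding starts with a ⊤-tag while a nonempty reversed encoding starts with a ⊥-tag (this is
-- where ε ∉ σ(y) is needed). Union and intersection commute with preimages; concatenation, and
-- hence ⁺, does too because all words of ⟦ e ⟧ σ″ have even length, so a factorisation of an
-- encoding into an even prefix and a suffix is a factorisation into encodings.
module Submission where

open import Defs
open import Data.Bool using (Bool; true; false)
open import Data.List using (List; []; _∷_; _++_; [_]; _∷ʳ_; reverse; length; initLast; _∷ʳ′_)
open import Data.List.Properties using (∷-injective; length-++; length-reverse; reverse-++; reverse-injective)
open import Data.Nat using (zero; suc)
open import Data.Nat.Divisibility using (_∣_; _∣0; ∣-refl; ∣1⇒≡1; ∣m∣n⇒∣m+n; ∣m+n∣m⇒∣n)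
open import Data.Product using (Σ; ∃-syntax; _×_; _,_; proj₁; proj₂)
open import Data.Sum using (_⊎_; inj₁; inj₂)
open import Data.Empty using (⊥-elim)
open import Relation.Binary.PropositionalEquality using (_≡_; refl; sym; trans; cong; subst; module ≡-Reasoning)
open import Relation.Nullary using (¬_; contradiction)

private
  variable
    Σ₀ : Set
    L L₁ L₂ M M₁ M₂ : Lang Σ₀

double : List Σ₀ → List (Σ₀ × Bool)
double [] = []
double (a ∷ w) = (a , true) ∷ (a , false) ∷ double w

double⁻¹ : Lang (Σ₀ × Bool) → Lang Σ₀
double⁻¹ M w = M (double w)

EvenLength : Lang Σ₀ → Set
EvenLength M = ∀ v → M v → 2 ∣ length v

double-++ : (w₁ w₂ : List Σ₀) → double (w₁ ++ w₂) ≡ double w₁ ++ double w₂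
double-++ [] w₂ = refl
double-++ (a ∷ w₁) w₂ = cong (λ v → (a , true) ∷ (a , false) ∷ v) (double-++ w₁ w₂)

double-injective : (w u : List Σ₀) → double w ≡ double u → w ≡ u
double-injective [] [] eq = refl
double-injective (a ∷ w) (b ∷ u) eq with ∷-injective eq
... | refl , eq′ = cong (a ∷_) (double-injective w u (proj₂ (∷-injective eq′)))

double-even : (w : List Σ₀) → 2 ∣ length (double w)
double-even [] = 2 ∣0
double-even (a ∷ w) = ∣m∣n⇒∣m+n ∣-refl (double-even w)

double-split : (w : List Σ₀) (u v : List (Σ₀ × Bool)) → double w ≡ u ++ v → 2 ∣ length u →
               ∃[ w₁ ] ∃[ w₂ ] (w ≡ w₁ ++ w₂ × u ≡ double w₁ × v ≡ double w₂)
double-split w [] v eq _ = [] , w , refl , refl , sym eq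
double-split (a ∷ w) (p ∷ []) v eq 2∣1 = contradiction (∣1⇒≡1 2∣1) λ ()
double-split (a ∷ w) (p ∷ q ∷ u) v eq 2∣2+u with ∷-injective eq
... | refl , eq′ with ∷-injective eq′
... | refl , eq″ with double-split w u v eq″ (∣m+n∣m⇒∣n 2∣2+u ∣-refl)
... | w₁ , w₂ , refl , refl , refl = a ∷ w₁ , w₂ , refl , refl , refl

reverse-double-∷ʳ : (v : List Σ₀) (z : Σ₀) →
                    reverse (double (v ∷ʳ z)) ≡ (z , false) ∷ (z , true) ∷ reverse (double v)
reverse-double-∷ʳ v z = begin
  reverse (double (v ++ [ z ]))          ≡⟨ cong reverse (double-++ v [ z ]) ⟩
  reverse (double v ++ double [ z ])     ≡⟨ reverse-++ (double v) (double [ z ]) ⟩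
  (z , false) ∷ (z , true) ∷ reverse (double v) ∎
  where open ≡-Reasoning

double≡reverse-double⇒[] : (w u : List Σ₀) → double w ≡ reverse (double u) → w ≡ [] × u ≡ []
double≡reverse-double⇒[] w u eq with initLast u
double≡reverse-double⇒[] [] .[] eq | [] = refl , refl
double≡reverse-double⇒[] w .(v ∷ʳ z) eq | v ∷ʳ′ z with trans eq (reverse-double-∷ʳ v z)
double≡reverse-double⇒[] [] .(v ∷ʳ z) eq | v ∷ʳ′ z | ()
double≡reverse-double⇒[] (a ∷ w) .(v ∷ʳ z) eq | v ∷ʳ′ z | ()

∪-cong : L₁ ≐ M₁ → L₂ ≐ M₂ → (L₁ ∪ L₂) ≐ (M₁ ∪ M₂)
∪-cong L₁≐M₁ L₂≐M₂ w =
  (λ { (inj₁ p) → inj₁ (proj₁ (L₁≐M₁ w) p) ; (inj₂ q) → inj₂ (proj₁ (L₂≐M₂ w) q) }) ,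
  (λ { (inj₁ p) → inj₁ (proj₂ (L₁≐M₁ w) p) ; (inj₂ q) → inj₂ (proj₂ (L₂≐M₂ w) q) })

∩-cong : L₁ ≐ M₁ → L₂ ≐ M₂ → (L₁ ∩ L₂) ≐ (M₁ ∩ M₂)
∩-cong L₁≐M₁ L₂≐M₂ w =
  (λ (p , q) → proj₁ (L₁≐M₁ w) p , proj₁ (L₂≐M₂ w) q) ,
  (λ (p , q) → proj₂ (L₁≐M₁ w) p , proj₂ (L₂≐M₂ w) q)

·-evenLength : EvenLength M₁ → EvenLength M₂ → EvenLength (M₁ · M₂)
·-evenLength even₁ even₂ ._ (u , v , refl , p , q) =
  subst (2 ∣_) (sym (length-++ u)) (∣m∣n⇒∣m+n (even₁ u p) (even₂ v q))

pow-evenLength : EvenLength M → ∀ n → EvenLength (pow M n)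
pow-evenLength even zero = even
pow-evenLength even (suc n) = ·-evenLength even (pow-evenLength even n)

⟦⟧-evenLength : {X : Set} {τ : X → Lang Σ₀} → (∀ x → EvenLength (τ x)) →
                (e : OExp X) → EvenLength (⟦ e ⟧ τ)
⟦⟧-evenLength even (var x) = even x
⟦⟧-evenLength even zer v ()
⟦⟧-evenLength even (e ⊕ f) v (inj₁ p) = ⟦⟧-evenLength even e v p
⟦⟧-evenLength even (e ⊕ f) v (inj₂ q) = ⟦⟧-evenLength even f v q
⟦⟧-evenLength even (e ⊙ f) = ·-evenLength (⟦⟧-evenLength even e) (⟦⟧-evenLength even f)
⟦⟧-evenLength even (e ⊓ f) v (p , _) = ⟦⟧-evenLength even e v p
⟦⟧-evenLength even (e ⁺) v (n , p) = pow-evenLength (⟦⟧-evenLength even e) n v p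
⟦⟧-evenLength even (mir e) v p =
  subst (2 ∣_) (length-reverse v) (⟦⟧-evenLength even e (reverse v) p)

·-double⁻¹ : EvenLength M₁ → L₁ ≐ double⁻¹ M₁ → L₂ ≐ double⁻¹ M₂ →
             (L₁ · L₂) ≐ double⁻¹ (M₁ · M₂)
·-double⁻¹ {M₁ = M₁} {M₂ = M₂} even₁ L₁≐ L₂≐ w = to , from
  where
  to : (_ · _) w → double⁻¹ (M₁ · M₂) w
  to (w₁ , w₂ , refl , p , q) =
    double w₁ , double w₂ , double-++ w₁ w₂ , proj₁ (L₁≐ w₁) p , proj₁ (L₂≐ w₂) q
  from : double⁻¹ (M₁ · M₂) w → (_ · _) w
  from (u , v , eq , p , q) with double-split w u v eq (even₁ u p)
  ... | w₁ , w₂ , w≡ , refl , refl = w₁ , w₂ , w≡ , proj₂ (L₁≐ w₁) p , proj₂ (L₂≐ w₂) q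

pow-double⁻¹ : EvenLength M → L ≐ double⁻¹ M → ∀ n → pow L n ≐ double⁻¹ (pow M n)
pow-double⁻¹ even L≐ zero = L≐
pow-double⁻¹ even L≐ (suc n) = ·-double⁻¹ even L≐ (pow-double⁻¹ even L≐ n)

plus-double⁻¹ : EvenLength M → L ≐ double⁻¹ M → plus L ≐ double⁻¹ (plus M)
plus-double⁻¹ even L≐ w =
  (λ (n , p) → n , proj₁ (pow-double⁻¹ even L≐ n w) p) ,
  (λ (n , p) → n , proj₂ (pow-double⁻¹ even L≐ n w) p)

module _ (X : Set) (A : Set) (σ : X × Bool → Lang A) (ε∉σ : ∀ y → ¬ σ y []) where

  σ″ : X → Lang (A × Bool)
  σ″ x v = (∃[ w ] (v ≡ double w × σ (x , true) w))
         ⊎ (∃[ w ] (v ≡ reverse (double w) × σ (x , false) w))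

  σ″-evenLength : ∀ x → EvenLength (σ″ x)
  σ″-evenLength x ._ (inj₁ (w , refl , _)) = double-even w
  σ″-evenLength x ._ (inj₂ (w , refl , _)) =
    subst (2 ∣_) (sym (length-reverse (double w))) (double-even w)

  var-double⁻¹ : ∀ x → σ (x , true) ≐ double⁻¹ (σ″ x)
  var-double⁻¹ x w = (λ p → inj₁ (w , refl , p)) , from
    where
    from : σ″ x (double w) → σ (x , true) w
    from (inj₁ (u , eq , p)) = subst (σ (x , true)) (sym (double-injective w u eq)) p
    from (inj₂ (u , eq , p)) with proj₂ (double≡reverse-double⇒[] w u eq)
    ... | refl = ⊥-elim (ε∉σ _ p)

  mirv-double⁻¹ : ∀ x → σ (x , false) ≐ double⁻¹ (mirror (σ″ x))
  mirv-double⁻¹ x w = (λ p → inj₂ (w , refl , p)) , from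
    where
    from : σ″ x (reverse (double w)) → σ (x , false) w
    from (inj₁ (u , eq , p)) with double≡reverse-double⇒[] u w (sym eq)
    ... | refl , refl = ⊥-elim (ε∉σ _ p)
    from (inj₂ (u , eq , p)) =
      subst (σ (x , false)) (sym (double-injective w u (reverse-injective eq))) p

  ↑-double⁻¹ : {e : OExp X} (c : Clean e) → ⟦ ↑ c ⟧ˢ σ ≐ double⁻¹ (⟦ e ⟧ σ″)
  ↑-double⁻¹ (var x) = var-double⁻¹ x
  ↑-double⁻¹ (mirv x) = mirv-double⁻¹ x
  ↑-double⁻¹ zer w = (λ ()) , (λ ())
  ↑-double⁻¹ (c ⊕ d) = ∪-cong (↑-double⁻¹ c) (↑-double⁻¹ d)
  ↑-double⁻¹ (_⊙_ {e} c d) =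
    ·-double⁻¹ (⟦⟧-evenLength σ″-evenLength e) (↑-double⁻¹ c) (↑-double⁻¹ d)
  ↑-double⁻¹ (c ⊓ d) = ∩-cong (↑-double⁻¹ c) (↑-double⁻¹ d)
  ↑-double⁻¹ (_⁺ {e} c) = plus-double⁻¹ (⟦⟧-evenLength σ″-evenLength e) (↑-double⁻¹ c)

lemma8 : (X : Set) (A : Set) (σ : X × Bool → Lang A) →
    (∀ y → ¬ σ y []) →
    ∃[ A′ ] Σ (X → Lang A′) λ σ″ → Σ (Lang A′ → Lang A) λ ψ →
      ∀ (e : OExp X) (c : Clean e) → ⟦ ↑ c ⟧ˢ σ ≐ ψ (⟦ e ⟧ σ″)
lemma8 X A σ ε∉σ = (A × Bool) , σ″ X A σ ε∉σ , double⁻¹ , λ _ → ↑-double⁻¹ X A σ ε∉σ
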